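{- Let $D$ be a directed graph on $[n]$ (loops allowed) with $m\ge 1$ arcs. Then $\mathrm{minrank}[D]=\mathrm{minrank}[D,(n+1)m]$.
   Context: For an integer $q\ge 2$ let $\langle q\rangle=\{0,1,\dots,q-1\}$. For $f=(f_1,\dots,f_n):\langle q\rangle^n\to\langle q\rangle^n$, the interaction graph $\mathrm{IG}(f)$ is the directed graph on $[n]$ with an arc $uv$ (possibly $u=v$) if and only if there exist $a,b\in\langle q\rangle^n$ that differ only in coordinate $u$ and satisfy $f_v(a)\ne f_v(b)$. $F[D,q]$ is the set of all $f:\langle q\rangle^n\to\langle q\rangle^n$ with $\mathrm{IG}(f)=D$ exactly; $\operatorname{rank}(f)=|\{f(y): y\in\langle q\rangle^n\}|$; $\mathrm{minrank}[D,q]=\min\{\operatorname{rank}(f): f\in F[D,q]\}$; and $\mathrm{minrank}[D]=\min\{\mathrm{minrank}[D,q]:q\ge 2\}$. -}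

module Defs where

open import Data.Nat using (ℕ; _+_; _*_; _≤_)
open import Data.Bool using (Bool; true; false; if_then_else_)
open import Data.Fin using (Fin)
open import Data.Vec using (Vec; lookup)
open import Data.List using (List; length; map; allFin)
open import Data.Nat.ListAction using (sum)
open import Data.List.Relation.Unary.Unique.Propositional using (Unique)
open import Data.List.Membership.Propositional using (_∈_)
open import Data.Product using (Σ; ∃; ∃-syntax; _×_)
open import Relation.Binary.PropositionalEquality using (_≡_; _≢_)
open import Function.Bundles using (_⇔_)

Digraph : ℕ → Set
Digraph n = Fin n → Fin n → Bool

arcCount : ∀ {n} → Digraph n → ℕ
arcCount {n} D = sum (map (λ u → sum (map (λ v → if D u v then 1 else 0) (allFin n))) (allFin n))

State : ℕ → ℕ → Set
State q n = Vec (Fin q) n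

-- maps f : ⟨q⟩^n → ⟨q⟩^n ; f_v(a) = lookup (f a) v
Map : ℕ → ℕ → Set
Map q n = State q n → State q n

DifferOnlyIn : ∀ {q n} → Fin n → State q n → State q n → Set
DifferOnlyIn {n = n} u a b = (w : Fin n) → w ≢ u → lookup a w ≡ lookup b w

IGArc : ∀ {q n} → Map q n → Fin n → Fin n → Set
IGArc {q} {n} f u v =
  ∃[ a ] ∃[ b ] (DifferOnlyIn u a b × lookup (f a) v ≢ lookup (f b) v)

InF : ∀ {n} → Digraph n → (q : ℕ) → Map q n → Set
InF {n} D q f = (u v : Fin n) → (D u v ≡ true) ⇔ IGArc f u v

HasRank : ∀ {q n} → Map q n → ℕ → Set
HasRank {q} {n} f r =
  Σ (List (State q n)) λ ys →
    Unique ys × ((y : State q n) → (y ∈ ys) ⇔ (∃[ x ] f x ≡ y)) × length ys ≡ r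

IsMinrankQ : ∀ {n} → Digraph n → ℕ → ℕ → Set
IsMinrankQ {n} D q r =
  (Σ (Map q n) λ f → InF D q f × HasRank f r) ×
  ((f : Map q n) (s : ℕ) → InF D q f → HasRank f s → r ≤ s)

IsMinrank : ∀ {n} → Digraph n → ℕ → Set
IsMinrank D r =
  (∃[ q ] (2 ≤ q × IsMinrankQ D q r)) ×
  ((q s : ℕ) → 2 ≤ q → IsMinrankQ D q s → r ≤ s)

-- Over every alphabet of size at least 2, D is realised by the threshold map
-- x ↦ (v ↦ [some in-neighbour w of v has x_w ≠ 0]), and there are finitely many maps, so
-- minrank[D,q] exists for every q ≥ 2. Now take any f ∈ F[D,q]. Each arc uv of D is witnessed
-- by a pair of states (a, b); these witnesses mention at most (n + 1)m input symbols (a, and b_u)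
-- and at most 2m ≤ (n + 1)m output symbols. If Q ≥ (n + 1)m, decode ⟨Q⟩ onto the input symbols
-- and encode the output symbols injectively into ⟨Q⟩: the resulting g : ⟨Q⟩ⁿ → ⟨Q⟩ⁿ keeps every
-- witnessed arc, creates no new ones, and its image is a projection of the image of f. Hence
-- minrank[D,Q] ≤ minrank[D,q] for every q.
module Submission where

open import Defs
open import Data.Nat using (ℕ; zero; suc; _+_; _*_; _≤_; _<_; z≤n; s≤s; NonZero)
open import Data.Nat.Properties
  using (≤-refl; ≤-reflexive; ≤-trans; <-≤-trans; +-mono-≤; *-mono-≤; +-comm; m≤n+m;
         *-zeroʳ; *-identityʳ; *-distribˡ-+)
open import Data.Nat.DivMod using (_mod_; m<n⇒m%n≡m)
open import Data.Nat.ListAction using (sum)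
open import Data.Bool using (Bool; true; false; if_then_else_)
import Data.Bool.Properties as Bool
open import Data.Fin using (Fin; zero; suc; toℕ; _≟_)
open import Data.Fin.Properties using (all?; any?; toℕ-fromℕ<; 0≢1+n)
open import Data.Vec using (Vec; []; _∷_; lookup; tabulate; replicate; _[_]≔_)
import Data.Vec as Vec
import Data.Vec.Properties as Vec
open import Data.List
  using (List; []; _∷_; length; map; allFin; filter; deduplicate; cartesianProductWith; concatMap)
import Data.List as List
open import Data.List.Properties using (filter-notAll; map-cong; length-++; length-map; length-tabulate)
open import Data.List.Relation.Unary.Any using (here; there; satisfied)
import Data.List.Relation.Unary.Any as Any
import Data.List.Relation.Unary.All as All
open import Data.List.Relation.Unary.All.Properties using (all-filter)
open import Data.List.Relation.Unary.Unique.Propositional using (Unique; []; _∷_)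
open import Data.List.Relation.Unary.Unique.DecPropositional.Properties using (deduplicate-!)
open import Data.List.Relation.Binary.Subset.Propositional using (_⊆_)
open import Data.List.Membership.Propositional using (_∈_; lose)
open import Data.List.Membership.Propositional.Properties
  using (∈-map⁺; ∈-map⁻; ∈-filter⁺; ∈-allFin; ∈-deduplicate⁺; ∈-deduplicate⁻;
         ∈-cartesianProductWith⁺; ∈-concatMap⁺; ∈-tabulate⁺)
open import Data.List.Extrema.Nat using (argmin; argmin-all; f[argmin]≤f[xs])
open import Data.Product using (∃; ∃-syntax; _×_; _,_; proj₁; proj₂; uncurry)
open import Data.Empty using (⊥-elim)
open import Function using (_∘_)
open import Function.Bundles using (_⇔_; mk⇔; Equivalence)
open import Relation.Binary.Definitions using (DecidableEquality)
open import Relation.Binary.PropositionalEquality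
  using (_≡_; _≢_; _≗_; refl; sym; trans; cong; cong₂; subst; module ≡-Reasoning)
open import Relation.Nullary using (Dec; yes; no; ¬_; ¬?; does)
open import Relation.Nullary.Decidable
  using (map′; _×-dec_; _→-dec_; dec-true; dec-false; does-⇔; decidable-stable)
open import Relation.Unary using (Decidable)

private
  variable
    n q Q s : ℕ
    A B : Set

unique-⊆⇒length-≤ : DecidableEquality A → {xs ys : List A} → Unique xs → xs ⊆ ys →
  length xs ≤ length ys
unique-⊆⇒length-≤ _≟ₐ_ {[]} _ _ = z≤n
unique-⊆⇒length-≤ _≟ₐ_ {x ∷ xs} {ys} (x∉xs ∷ xs!) xs⊆ys =
  ≤-trans (s≤s (unique-⊆⇒length-≤ _≟ₐ_ xs! xs⊆ys-x))
          (filter-notAll (λ y → ¬? (x ≟ₐ y)) ys (Any.map (λ x≡y x≢y → x≢y x≡y) (xs⊆ys (here refl))))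
  where
  xs⊆ys-x : xs ⊆ filter (λ y → ¬? (x ≟ₐ y)) ys
  xs⊆ys-x z∈xs = ∈-filter⁺ _ (xs⊆ys (there z∈xs)) (All.lookup x∉xs z∈xs)

length-concatMap-≤ : (g : A → List B) (k : A → ℕ) (c : ℕ) (xs : List A) →
  (∀ x → length (g x) ≤ c * k x) → length (concatMap g xs) ≤ c * sum (map k xs)
length-concatMap-≤ g k c [] _ = ≤-reflexive (sym (*-zeroʳ c))
length-concatMap-≤ g k c (x ∷ xs) bound = ≤-trans
  (≤-reflexive (length-++ (g x)))
  (≤-trans (+-mono-≤ (bound x) (length-concatMap-≤ g k c xs bound))
           (≤-reflexive (sym (*-distribˡ-+ c (k x) (sum (map k xs))))))

_⇔-dec_ : {P R : Set} → Dec P → Dec R → Dec (P ⇔ R)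
p? ⇔-dec r? = map′ (uncurry mk⇔) (λ e → Equivalence.to e , Equivalence.from e)
                   ((p? →-dec r?) ×-dec (r? →-dec p?))

map-id-local : (g : A → A) (xs : Vec A n) → (∀ i → g (lookup xs i) ≡ lookup xs i) →
  Vec.map g xs ≡ xs
map-id-local g []       _     = refl
map-id-local g (x ∷ xs) fixed = cong₂ _∷_ (fixed zero) (map-id-local g xs (fixed ∘ suc))

lookupOr : A → List A → ℕ → A
lookupOr d []       _       = d
lookupOr d (y ∷ ys) zero    = y
lookupOr d (y ∷ ys) (suc i) = lookupOr d ys i

module _ (_≟ₐ_ : DecidableEquality A) where

  -- Index of the first occurrence, or length ys when absent.
  position : List A → A → ℕ
  position []       x = 0
  position (y ∷ ys) x = if does (x ≟ₐ y) then 0 else suc (position ys x)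

  position-< : ∀ {x} ys → x ∈ ys → position ys x < length ys
  position-< {x} (y ∷ ys) x∈ with x ≟ₐ y | x∈
  ... | yes _  | _          = s≤s z≤n
  ... | no x≢y | here x≡y   = ⊥-elim (x≢y x≡y)
  ... | no _   | there x∈ys = s≤s (position-< ys x∈ys)

  lookupOr-position : ∀ d {x} ys → x ∈ ys → lookupOr d ys (position ys x) ≡ x
  lookupOr-position d {x} (y ∷ ys) x∈ with x ≟ₐ y | x∈
  ... | yes x≡y | _          = sym x≡y
  ... | no x≢y  | here x≡y   = ⊥-elim (x≢y x≡y)
  ... | no _    | there x∈ys = lookupOr-position d ys x∈ys

module Retraction (_≟ₐ_ : DecidableEquality A) (d : A) (L : List A) (Q : ℕ) .{{_ : NonZero Q}}
                  (L-small : length L ≤ Q) where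

  encode : A → Fin Q
  encode x = position _≟ₐ_ L x mod Q

  decode : Fin Q → A
  decode j = lookupOr d L (toℕ j)

  decode-encode : ∀ {x} → x ∈ L → decode (encode x) ≡ x
  decode-encode {x} x∈L = trans (cong (lookupOr d L) toℕ-encode) (lookupOr-position _≟ₐ_ d L x∈L)
    where
    toℕ-encode : toℕ (encode x) ≡ position _≟ₐ_ L x
    toℕ-encode = trans (toℕ-fromℕ< _) (m<n⇒m%n≡m (<-≤-trans (position-< _≟ₐ_ L x∈L) L-small))

  encode-injective : ∀ {x y} → x ∈ L → y ∈ L → encode x ≡ encode y → x ≡ y
  encode-injective x∈L y∈L eq = trans (sym (decode-encode x∈L)) (trans (cong decode eq) (decode-encode y∈L))

-- Ranks

states : (q n : ℕ) → List (State q n)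
states q zero    = [] ∷ []
states q (suc n) = cartesianProductWith _∷_ (allFin q) (states q n)

∈-states : (x : State q n) → x ∈ states q n
∈-states []      = here refl
∈-states (a ∷ x) = ∈-cartesianProductWith⁺ _∷_ (∈-allFin a) (∈-states x)

_≟ₛ_ : DecidableEquality (State q n)
_≟ₛ_ = Vec.≡-dec _≟_

image : Map q n → List (State q n)
image {q} {n} f = deduplicate _≟ₛ_ (map f (states q n))

rank : Map q n → ℕ
rank f = length (image f)

image-unique : (f : Map q n) → Unique (image f)
image-unique {q} {n} f = deduplicate-! _≟ₛ_ (map f (states q n))

∈-image⁺ : (f : Map q n) (x : State q n) → f x ∈ image f
∈-image⁺ f x = ∈-deduplicate⁺ _≟ₛ_ (∈-map⁺ f (∈-states x))

∈-image⁻ : (f : Map q n) {y : State q n} → y ∈ image f → ∃[ x ] f x ≡ y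
∈-image⁻ {q} {n} f y∈ with ∈-map⁻ f (∈-deduplicate⁻ _≟ₛ_ (map f (states q n)) y∈)
... | x , _ , y≡fx = x , sym y≡fx

hasRank-rank : (f : Map q n) → HasRank f (rank f)
hasRank-rank f = image f , image-unique f , (λ y → mk⇔ (∈-image⁻ f) from) , refl
  where
  from : ∀ {y} → ∃[ x ] f x ≡ y → y ∈ image f
  from (x , refl) = ∈-image⁺ f x

rank-≤ : (f : Map q n) (ys : List (State q n)) → (∀ x → f x ∈ ys) → rank f ≤ length ys
rank-≤ f ys covers = unique-⊆⇒length-≤ _≟ₛ_ (image-unique f) image⊆ys
  where
  image⊆ys : image f ⊆ ys
  image⊆ys y∈ with ∈-image⁻ f y∈
  ... | x , refl = covers x

hasRank⇒rank-≤ : (f : Map q n) → HasRank f s → rank f ≤ s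
hasRank⇒rank-≤ f (ys , _ , ys≡img , refl) =
  rank-≤ f ys (λ x → Equivalence.from (ys≡img (f x)) (x , refl))

rank-cong : {f g : Map q n} → f ≗ g → rank f ≡ rank g
rank-cong {q} {n} f≗g = cong (length ∘ deduplicate _≟ₛ_) (map-cong f≗g (states q n))

-- Decidability of F[D,q]

differOnlyIn-sym : {u : Fin n} {x y : State q n} → DifferOnlyIn u x y → DifferOnlyIn u y x
differOnlyIn-sym dxy w w≢u = sym (dxy w w≢u)

∃ₛ? : {P : State q n → Set} → Decidable P → Dec (∃ P)
∃ₛ? {q} {n} P? = map′ satisfied (λ (x , px) → lose (∈-states x) px) (Any.any? P? (states q n))

differOnlyIn? : (u : Fin n) (a b : State q n) → Dec (DifferOnlyIn u a b)
differOnlyIn? u a b = all? (λ w → ¬? (w ≟ u) →-dec (lookup a w ≟ lookup b w))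

IGArc? : (f : Map q n) (u v : Fin n) → Dec (IGArc f u v)
IGArc? f u v = ∃ₛ? λ a → ∃ₛ? λ b → differOnlyIn? u a b ×-dec ¬? (lookup (f a) v ≟ lookup (f b) v)

InF? : (D : Digraph n) (q : ℕ) (f : Map q n) → Dec (InF D q f)
InF? D q f = all? λ u → all? λ v → (D u v Bool.≟ true) ⇔-dec IGArc? f u v

IGArc-resp-≗ : {f g : Map q n} → f ≗ g → ∀ {u v} → IGArc f u v → IGArc g u v
IGArc-resp-≗ {f = f} {g} f≗g {v = v} (a , b , dab , fa≢fb) = a , b , dab , λ ga≡gb →
  fa≢fb (trans (cong (λ y → lookup y v) (f≗g a)) (trans ga≡gb (cong (λ y → lookup y v) (sym (f≗g b)))))

InF-resp-≗ : (D : Digraph n) {f g : Map q n} → f ≗ g → InF D q f → InF D q g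
InF-resp-≗ D f≗g f∈F u v = mk⇔
  (IGArc-resp-≗ f≗g ∘ Equivalence.to (f∈F u v))
  (Equivalence.from (f∈F u v) ∘ IGArc-resp-≗ (sym ∘ f≗g))

-- Existence of minrank[D,q]

module _ (g₀ : Map q n) where

  override : State q n → State q n → Map q n → Map q n
  override x y g z = if does (z ≟ₛ x) then y else g z

  maps : List (State q n) → List (Map q n)
  maps []       = g₀ ∷ []
  maps (x ∷ xs) = cartesianProductWith (override x) (states q n) (maps xs)

  maps-complete : (xs : List (State q n)) (f : Map q n) →
    ∃[ g ] (g ∈ maps xs × ∀ {z} → z ∈ xs → f z ≡ g z)
  maps-complete []       f = g₀ , here refl , λ ()
  maps-complete (x ∷ xs) f with maps-complete xs f
  ... | g , g∈ , agree = override x (f x) g ,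
                         ∈-cartesianProductWith⁺ (override x) (∈-states (f x)) g∈ , agree′
    where
    agree′ : ∀ {z} → z ∈ x ∷ xs → f z ≡ override x (f x) g z
    agree′ {z} z∈ with z ≟ₛ x | z∈
    ... | yes refl | _         = refl
    ... | no z≢x   | here z≡x  = ⊥-elim (z≢x z≡x)
    ... | no _     | there z∈′ = agree z∈′

  maps-states-complete : (f : Map q n) → ∃[ g ] (g ∈ maps (states q n) × f ≗ g)
  maps-states-complete f with maps-complete (states q n) f
  ... | g , g∈ , agree = g , g∈ , agree ∘ ∈-states

minrankQ-exists : (D : Digraph n) (f₀ : Map q n) → InF D q f₀ → ∃[ r ] IsMinrankQ D q r
minrankQ-exists {n} {q} D f₀ f₀∈F = rank m , (m , m∈F , hasRank-rank m) , minimal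
  where
  candidates : List (Map q n)
  candidates = filter (InF? D q) (maps f₀ (states q n))

  m : Map q n
  m = argmin rank f₀ candidates

  m∈F : InF D q m
  m∈F = argmin-all rank f₀∈F (all-filter (InF? D q) (maps f₀ (states q n)))

  minimal : (f : Map q n) (s : ℕ) → InF D q f → HasRank f s → rank m ≤ s
  minimal f s f∈F f-rank with maps-states-complete f₀ f
  ... | g , g∈ , f≗g = ≤-trans
    (All.lookup (f[argmin]≤f[xs] f₀ candidates) (∈-filter⁺ (InF? D q) g∈ (InF-resp-≗ D f≗g f∈F)))
    (≤-trans (≤-reflexive (sym (rank-cong f≗g))) (hasRank⇒rank-≤ f f-rank))

-- The threshold map

module Threshold {k : ℕ} (D : Digraph n) where

  Excited : State (2 + k) n → Fin n → Set
  Excited x v = ∃[ w ] (D w v ≡ true × lookup x w ≢ zero)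

  excited? : (x : State (2 + k) n) (v : Fin n) → Dec (Excited x v)
  excited? x v = any? λ w → (D w v Bool.≟ true) ×-dec ¬? (lookup x w ≟ zero)

  bit : Bool → Fin (2 + k)
  bit false = zero
  bit true  = suc zero

  threshold : Map (2 + k) n
  threshold x = tabulate λ v → bit (does (excited? x v))

  lookup-threshold : ∀ x v → lookup (threshold x) v ≡ bit (does (excited? x v))
  lookup-threshold x v = Vec.lookup∘tabulate _ v

  excited-transfer : ∀ {u v x y} → D u v ≢ true → DifferOnlyIn u x y → Excited x v → Excited y v
  excited-transfer {u} ¬uv dxy (w , wv , xw≢0) with w ≟ u
  ... | yes refl = ⊥-elim (¬uv wv)
  ... | no w≢u   = w , wv , λ yw≡0 → xw≢0 (trans (dxy w w≢u) yw≡0)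

  threshold-local : ∀ {u v x y} → D u v ≢ true → DifferOnlyIn u x y →
    lookup (threshold x) v ≡ lookup (threshold y) v
  threshold-local {u} {v} {x} {y} ¬uv dxy = begin
    lookup (threshold x) v        ≡⟨ lookup-threshold x v ⟩
    bit (does (excited? x v))     ≡⟨ cong bit (does-⇔ excited⇔ (excited? x v) (excited? y v)) ⟩
    bit (does (excited? y v))     ≡⟨ lookup-threshold y v ⟨
    lookup (threshold y) v        ∎
    where
    open ≡-Reasoning
    excited⇔ : Excited x v ⇔ Excited y v
    excited⇔ = mk⇔ (excited-transfer {u} {v} {x} {y} ¬uv dxy)
                   (excited-transfer {u} {v} {y} {x} ¬uv (differOnlyIn-sym {u = u} {x} {y} dxy))

  threshold-InF : InF D (2 + k) threshold
  threshold-InF u v = mk⇔ arc⇒ig ig⇒arc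
    where
    ig⇒arc : IGArc threshold u v → D u v ≡ true
    ig⇒arc (x , y , dxy , ≢) =
      decidable-stable (D u v Bool.≟ true) λ ¬uv → ≢ (threshold-local {u} {v} {x} {y} ¬uv dxy)

    x₀ : State (2 + k) n
    x₀ = replicate n zero

    x₁ : State (2 + k) n
    x₁ = x₀ [ u ]≔ suc zero

    arc⇒ig : D u v ≡ true → IGArc threshold u v
    arc⇒ig uv = x₀ , x₁ , (λ w w≢u → sym (Vec.lookup∘update′ w≢u x₀ _)) , outputs-differ
      where
      quiet : ¬ Excited x₀ v
      quiet (w , _ , x₀w≢0) = x₀w≢0 (Vec.lookup-replicate w zero)

      excited : Excited x₁ v
      excited = u , uv , λ x₁u≡0 → 0≢1+n (trans (sym x₁u≡0) (Vec.lookup∘update u x₀ _))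

      outputs-differ : lookup (threshold x₀) v ≢ lookup (threshold x₁) v
      outputs-differ eq
        rewrite lookup-threshold x₀ v | lookup-threshold x₁ v
              | dec-false (excited? x₀ v) quiet | dec-true (excited? x₁ v) excited
        with () ← eq

-- Change of alphabet

differOnlyIn-map : (g : Fin q → Fin Q) {u : Fin n} {a b : State q n} →
  DifferOnlyIn u a b → DifferOnlyIn u (Vec.map g a) (Vec.map g b)
differOnlyIn-map g {a = a} {b} dab w w≢u =
  trans (Vec.lookup-map w g a) (trans (cong g (dab w w≢u)) (sym (Vec.lookup-map w g b)))

module Compression (f : Map q n) (ι : Fin Q → Fin q) (π : Fin q → Fin Q) where

  compress : Map Q n
  compress x = Vec.map π (f (Vec.map ι x))

  lookup-compress : ∀ x v → lookup (compress x) v ≡ π (lookup (f (Vec.map ι x)) v)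
  lookup-compress x v = Vec.lookup-map v π (f (Vec.map ι x))

  IGArc-compress⁻ : ∀ {u v} → IGArc compress u v → IGArc f u v
  IGArc-compress⁻ {v = v} (x , y , dxy , ≢) =
    Vec.map ι x , Vec.map ι y , differOnlyIn-map ι {a = x} {y} dxy , λ eq → ≢ (trans (lookup-compress x v) (trans (cong π eq) (sym (lookup-compress y v))))

  IGArc-compress⁺ : (σ : Fin q → Fin Q) {u v : Fin n} {a b : State q n} →
    Vec.map ι (Vec.map σ a) ≡ a → Vec.map ι (Vec.map σ b) ≡ b → DifferOnlyIn u a b →
    π (lookup (f a) v) ≢ π (lookup (f b) v) → IGArc compress u v
  IGArc-compress⁺ σ {v = v} {a} {b} ισa ισb dab ≢ =
    Vec.map σ a , Vec.map σ b , differOnlyIn-map σ {a = a} {b} dab , λ eq → ≢ (begin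
      π (lookup (f a) v)                           ≡⟨ cong (λ z → π (lookup (f z) v)) ισa ⟨
      π (lookup (f (Vec.map ι (Vec.map σ a))) v)   ≡⟨ lookup-compress (Vec.map σ a) v ⟨
      lookup (compress (Vec.map σ a)) v            ≡⟨ eq ⟩
      lookup (compress (Vec.map σ b)) v            ≡⟨ lookup-compress (Vec.map σ b) v ⟩
      π (lookup (f (Vec.map ι (Vec.map σ b))) v)   ≡⟨ cong (λ z → π (lookup (f z) v)) ισb ⟩
      π (lookup (f b) v)                           ∎)
    where open ≡-Reasoning

  rank-compress-≤ : HasRank f s → rank compress ≤ s
  rank-compress-≤ (ys , _ , ys≡img , refl) =
    ≤-trans (rank-≤ compress (map (Vec.map π) ys) covers) (≤-reflexive (length-map (Vec.map π) ys))
    where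
    covers : ∀ x → compress x ∈ map (Vec.map π) ys
    covers x = ∈-map⁺ (Vec.map π) (Equivalence.from (ys≡img _) (Vec.map ι x , refl))

module _ (D : Digraph n) where

  arcConcat : (Fin n → Fin n → List A) → List A
  arcConcat h = concatMap (λ u → concatMap (λ v → if D u v then h u v else []) (allFin n)) (allFin n)

  ∈-arcConcat : (h : Fin n → Fin n → List A) {u v : Fin n} {x : A} →
    D u v ≡ true → x ∈ h u v → x ∈ arcConcat h
  ∈-arcConcat h {u} {v} {x} uv x∈ =
    ∈-concatMap⁺ _ (lose (∈-allFin u) (∈-concatMap⁺ _ (lose (∈-allFin v) x∈′)))
    where
    x∈′ : x ∈ (if D u v then h u v else [])
    x∈′ rewrite uv = x∈

  length-arcConcat-≤ : (h : Fin n → Fin n → List A) (c : ℕ) → (∀ u v → length (h u v) ≤ c) →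
    length (arcConcat h) ≤ c * arcCount D
  length-arcConcat-≤ h c bound =
    length-concatMap-≤ _ _ c (allFin n) λ u → length-concatMap-≤ _ _ c (allFin n) (per-arc u)
    where
    per-arc : ∀ u v → length (if D u v then h u v else []) ≤ c * (if D u v then 1 else 0)
    per-arc u v with D u v
    ... | true  = ≤-trans (bound u v) (≤-reflexive (sym (*-identityʳ c)))
    ... | false = z≤n

fin⇒2≤n+1 : Fin n → 2 ≤ n + 1
fin⇒2≤n+1 {suc n} _ = s≤s (m≤n+m 1 n)

module Transfer (D : Digraph n) (f : Map (suc q) n) (f∈F : InF D (suc q) f)
                .{{_ : NonZero Q}} (Q-large : (n + 1) * arcCount D ≤ Q) where

  Witness : Fin n → Fin n → State (suc q) n × State (suc q) n → Set
  Witness u v (a , b) = DifferOnlyIn u a b × lookup (f a) v ≢ lookup (f b) v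

  witness : Fin n → Fin n → State (suc q) n × State (suc q) n
  witness u v with IGArc? f u v
  ... | yes (a , b , _) = a , b
  ... | no _            = replicate n zero , replicate n zero

  witness-correct : ∀ {u v} → D u v ≡ true → Witness u v (witness u v)
  witness-correct {u} {v} uv with IGArc? f u v
  ... | yes (_ , _ , ok) = ok
  ... | no ¬arc          = ⊥-elim (¬arc (Equivalence.to (f∈F u v) uv))

  inputs : Fin n → Fin n → List (Fin (suc q))
  inputs u v = let a , b = witness u v in lookup b u ∷ List.tabulate (lookup a)

  outputs : Fin n → Fin n → List (Fin (suc q))
  outputs u v = let a , b = witness u v in lookup (f a) v ∷ lookup (f b) v ∷ []

  length-inputs : ∀ u v → length (inputs u v) ≤ n + 1
  length-inputs u v = ≤-reflexive (trans (cong suc (length-tabulate _)) (+-comm 1 n))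

  module In = Retraction _≟_ zero (arcConcat D inputs) Q
    (≤-trans (length-arcConcat-≤ D inputs (n + 1) length-inputs) Q-large)

  module Out = Retraction _≟_ zero (arcConcat D outputs) Q
    (≤-trans (length-arcConcat-≤ D outputs (n + 1) (λ u _ → fin⇒2≤n+1 u)) Q-large)

  open Compression f In.decode Out.encode public

  compress-InF : InF D Q compress
  compress-InF u v = mk⇔ arc⇒ig (Equivalence.from (f∈F u v) ∘ IGArc-compress⁻)
    where
    arc⇒ig : D u v ≡ true → IGArc compress u v
    arc⇒ig uv = IGArc-compress⁺ In.encode (decodes a a∈) (decodes b b∈) dab
               (fa≢fb ∘ Out.encode-injective (∈T (here refl)) (∈T (there (here refl))))
      where
      a = proj₁ (witness u v)
      b = proj₂ (witness u v)
      dab = proj₁ (witness-correct uv)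
      fa≢fb = proj₂ (witness-correct uv)

      ∈S : ∀ {x} → x ∈ inputs u v → x ∈ arcConcat D inputs
      ∈S = ∈-arcConcat D inputs uv

      ∈T : ∀ {x} → x ∈ outputs u v → x ∈ arcConcat D outputs
      ∈T = ∈-arcConcat D outputs uv

      a∈ : ∀ w → lookup a w ∈ arcConcat D inputs
      a∈ w = ∈S (there (∈-tabulate⁺ w))

      b∈ : ∀ w → lookup b w ∈ arcConcat D inputs
      b∈ w with w ≟ u
      ... | yes refl = ∈S (here refl)
      ... | no w≢u   = subst (_∈ arcConcat D inputs) (dab w w≢u) (a∈ w)

      decodes : ∀ x → (∀ w → lookup x w ∈ arcConcat D inputs) →
        Vec.map In.decode (Vec.map In.encode x) ≡ x
      decodes x x∈ = trans (sym (Vec.map-∘ In.decode In.encode x))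
                           (map-id-local _ x (In.decode-encode ∘ x∈))

minrankQ-≤-rank : (D : Digraph n) .{{_ : NonZero Q}} → (n + 1) * arcCount D ≤ Q →
  {r : ℕ} → IsMinrankQ D Q r → (f : Map (suc q) n) → InF D (suc q) f → HasRank f s → r ≤ s
minrankQ-≤-rank D Q-large (_ , minimal) f f∈F f-rank =
  ≤-trans (minimal compress (rank compress) compress-InF (hasRank-rank compress)) (rank-compress-≤ f-rank)
  where open Transfer D f f∈F Q-large

minrank-attained : (D : Digraph n) (Q : ℕ) → 2 ≤ Q → (n + 1) * arcCount D ≤ Q →
  ∃[ r ] (IsMinrank D r × IsMinrankQ D Q r)
minrank-attained D (suc zero) (s≤s ()) _
minrank-attained D Q@(suc (suc k)) 2≤Q Q-large
  with r , r-min ← minrankQ-exists D (Threshold.threshold {k = k} D) (Threshold.threshold-InF D) =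
  r , ((Q , 2≤Q , r-min) , below) , r-min
  where
  below : (q s : ℕ) → 2 ≤ q → IsMinrankQ D q s → r ≤ s
  below (suc q) s _ ((f , f∈F , f-rank) , _) = minrankQ-≤-rank D Q-large r-min f f∈F f-rank

theorem3p3 : (n : ℕ) (D : Digraph n) → 1 ≤ arcCount D →
    ∃[ r ] (IsMinrank D r × IsMinrankQ D ((n + 1) * arcCount D) r)
theorem3p3 zero    D ()
theorem3p3 (suc n) D 1≤m =
  minrank-attained D _ (*-mono-≤ (fin⇒2≤n+1 {suc n} zero) 1≤m) ≤-refl
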